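{- Fix $F\in NDF'$ and consider the class of $F$-coalgebras. Define $(S_1,f_1)\preccurlyeq(S_2,f_2)$ iff there exists a bisimulation $R\subseteq S_1\times S_2$ on them that is total on $S_1$. Define $(S_1,f_1)\otimes(S_2,f_2)=(R,g)$, where $R$ is the maximal bisimulation on $(S_1,f_1)$ and $(S_2,f_2)$ and $g:R\to F(R)$ is the witness mapping for $R$ that is maximal with respect to $\sqcup_F$. Let $\simeq\ =\ \preccurlyeq\cap\preccurlyeq^{ -1}$. Then $\preccurlyeq$ is a preorder and $(\{F\text{ -coalgebras}\}/\!\simeq,\ \preccurlyeq,\ \otimes)$ is a meet-semilattice, i.e. $(S_1,f_1)\otimes(S_2,f_2)$ is a greatest lower bound of $(S_1,f_1)$ and $(S_2,f_2)$ with respect to $\preccurlyeq$.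
   Context: $\mathbf{A}$ is a fixed set of actions. $NDF'$ is the class of functors on $\mathbf{Set}$ generated by the grammar $F::=\mathbf{Id}\mid \mathbf{B}\mid F\times F\mid F^{\mathbf{A}}\mid \mathcal{P}_\omega(F)$, where $\mathbf{Id}$ is the identity functor, $\mathbf{B}\neq\emptyset$ is a constant functor given by a join-semilattice with bottom (acting on maps as $id_{\mathbf{B}}$), $F_1\times F_2$ is the pointwise product, $G^{\mathbf{A}}(X)=G(X)^{\mathbf{A}}$ with $G^{\mathbf{A}}(f)(g)=G(f)\circ g$, and $\mathcal{P}_\omega(G)(X)$ is the set of finite subsets of $G(X)$ with $\mathcal{P}_\omega(G)(f)(S)=\{G(f)(x)\mid x\in S\}$. An $F$-coalgebra is a pair $(S,f)$ with $f:S\to F(S)$. A relation $R\subseteq S_1\times S_2$ is a bisimulation iff there is a map $g:R\to F(R)$ (a witness mapping) with $f_i\circ\pi_i=F(\pi_i)\circ g$ for the projections $\pi_i:R\to S_i$, $i=1,2$; unions of bisimulations are bisimulations, so a maximal bisimulation exists. For two witness mappings $g_1,g_2$ of $R$, $g_1\sqcup_F g_2$ is defined by induction on $F$: equal to $g_1(=g_2)$ for $F=\mathbf{Id},\mathbf{B}$; componentwise $(g_1^1\sqcup_{F_1}g_2^1)\times(g_1^2\sqcup_{F_2}g_2^2)$ for $F=F_1\times F_2$; $\lambda a.(g_1(a)\sqcup_G g_2(a))$ for $F=G^{\mathbf{A}}$; pointwise union $(s_1,s_2)\mapsto g_1(s_1,s_2)\cup g_2(s_1,s_2)$ for $F=\mathcal{P}_\omega(G)$;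 it is again a witness mapping, and "maximal with respect to $\sqcup_F$" means $g\sqcup_F g'=g$ for every witness mapping $g'$ of $R$. -}

module Defs where

open import Level using (0ℓ)
open import Data.Product using (Σ; Σ-syntax; ∃; ∃-syntax; _×_; _,_; proj₁; proj₂)
open import Data.List using (List; map; _++_)
open import Data.List.Relation.Unary.All using (All)
open import Data.List.Relation.Unary.Any using (Any)
open import Relation.Binary.PropositionalEquality using (_≡_)
open import Relation.Binary.Lattice.Bundles using (BoundedJoinSemilattice)

-- The class NDF' of functors, as syntax, over a fixed set of actions A.

data Fun (A : Set) : Set₁ where
  Id   : Fun A
  K    : BoundedJoinSemilattice 0ℓ 0ℓ 0ℓ → Fun A
  _⊗F_ : Fun A → Fun A → Fun A
  Exp  : Fun A → Fun A
  Pω   : Fun A → Fun A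

module _ {A : Set} where

  open BoundedJoinSemilattice

  -- action on objects (finite subsets represented by lists)
  ⟦_⟧ : Fun A → Set → Set
  ⟦ Id ⟧      X = X
  ⟦ K B ⟧     X = Carrier B
  ⟦ F ⊗F G ⟧  X = ⟦ F ⟧ X × ⟦ G ⟧ X
  ⟦ Exp G ⟧   X = A → ⟦ G ⟧ X
  ⟦ Pω G ⟧    X = List (⟦ G ⟧ X)

  fmap : (F : Fun A) {X Y : Set} → (X → Y) → ⟦ F ⟧ X → ⟦ F ⟧ Y
  fmap Id       f x       = f x
  fmap (K B)    f b       = b
  fmap (F ⊗F G) f (x , y) = fmap F f x , fmap G f y
  fmap (Exp G)  f h       = λ a → fmap G f (h a)
  fmap (Pω G)   f xs      = map (fmap G f) xs

  -- equality on F(X), given the equality of X.  Lists representing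
  -- finite subsets are equal iff they have the same elements
  -- (mutual inclusion); B uses its own equality.
  Eq : (F : Fun A) {X : Set} → (X → X → Set) → ⟦ F ⟧ X → ⟦ F ⟧ X → Set
  Eq Id       _≈X_ x y = x ≈X y
  Eq (K B)    _≈X_ x y = _≈_ B x y
  Eq (F ⊗F G) _≈X_ (x₁ , x₂) (y₁ , y₂) = Eq F _≈X_ x₁ y₁ × Eq G _≈X_ x₂ y₂
  Eq (Exp G)  _≈X_ h k = ∀ a → Eq G _≈X_ (h a) (k a)
  Eq (Pω G)   _≈X_ xs ys =
    All (λ x → Any (λ y → Eq G _≈X_ x y) ys) xs ×
    All (λ y → Any (λ x → Eq G _≈X_ x y) xs) ys

  join : (F : Fun A) {X : Set} → ⟦ F ⟧ X → ⟦ F ⟧ X → ⟦ F ⟧ X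
  join Id       x _ = x
  join (K B)    x _ = x
  join (F ⊗F G) (x₁ , x₂) (y₁ , y₂) = join F x₁ y₁ , join G x₂ y₂
  join (Exp G)  h k = λ a → join G (h a) (k a)
  join (Pω G)   xs ys = xs ++ ys

module _ {A : Set} (F : Fun A) where

  record Coalg : Set₁ where
    constructor coalg
    field
      St  : Set
      str : St → ⟦ F ⟧ St
  open Coalg public

  BRel : Set → Set → Set₁
  BRel S₁ S₂ = S₁ → S₂ → Set

  Carrier : {S₁ S₂ : Set} → BRel S₁ S₂ → Set
  Carrier {S₁} {S₂} R = Σ[ s₁ ∈ S₁ ] Σ[ s₂ ∈ S₂ ] R s₁ s₂

  π₁ : {S₁ S₂ : Set} {R : BRel S₁ S₂} → Carrier R → S₁
  π₁ (s₁ , _ , _) = s₁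

  π₂ : {S₁ S₂ : Set} {R : BRel S₁ S₂} → Carrier R → S₂
  π₂ (_ , s₂ , _) = s₂

  _≈R_ : {S₁ S₂ : Set} {R : BRel S₁ S₂} → Carrier R → Carrier R → Set
  r ≈R r' = (π₁ r ≡ π₁ r') × (π₂ r ≡ π₂ r')

  IsWitness : (C₁ C₂ : Coalg) (R : BRel (St C₁) (St C₂)) →
              (Carrier R → ⟦ F ⟧ (Carrier R)) → Set
  IsWitness C₁ C₂ R g =
    ∀ r → Eq F _≡_ (str C₁ (π₁ r)) (fmap F π₁ (g r))
        × Eq F _≡_ (str C₂ (π₂ r)) (fmap F π₂ (g r))

  IsBisim : (C₁ C₂ : Coalg) → BRel (St C₁) (St C₂) → Set
  IsBisim C₁ C₂ R = Σ[ g ∈ (Carrier R → ⟦ F ⟧ (Carrier R)) ] IsWitness C₁ C₂ R g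

  TotalOnLeft : {S₁ S₂ : Set} → BRel S₁ S₂ → Set
  TotalOnLeft {S₁} {S₂} R = ∀ (s₁ : S₁) → ∃[ s₂ ] R s₁ s₂

  _≼_ : Coalg → Coalg → Set₁
  C₁ ≼ C₂ = Σ[ R ∈ BRel (St C₁) (St C₂) ] IsBisim C₁ C₂ R × TotalOnLeft R

  IsMaxBisim : (C₁ C₂ : Coalg) → BRel (St C₁) (St C₂) → Set₁
  IsMaxBisim C₁ C₂ R =
    IsBisim C₁ C₂ R ×
    (∀ (R' : BRel (St C₁) (St C₂)) → IsBisim C₁ C₂ R' →
       ∀ s₁ s₂ → R' s₁ s₂ → R s₁ s₂)

  _⊔W_ : {X : Set} → (X → ⟦ F ⟧ X) → (X → ⟦ F ⟧ X) → X → ⟦ F ⟧ X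
  (g₁ ⊔W g₂) r = join F (g₁ r) (g₂ r)

  IsMaxWitness : (C₁ C₂ : Coalg) (R : BRel (St C₁) (St C₂)) →
                 (Carrier R → ⟦ F ⟧ (Carrier R)) → Set
  IsMaxWitness C₁ C₂ R g =
    IsWitness C₁ C₂ R g ×
    (∀ g' → IsWitness C₁ C₂ R g' →
       ∀ r → Eq F (_≈R_ {R = R}) ((g ⊔W g') r) (g r))

  IsGLB : Coalg → Coalg → Coalg → Set₁
  IsGLB C C₁ C₂ =
    (C ≼ C₁) × (C ≼ C₂) × (∀ D → D ≼ C₁ → D ≼ C₂ → D ≼ C)

module Submission where

-- Everything rests on two properties of the functors in NDF', both
-- proved by induction on the functor syntax, with F(X) compared by the
-- equality Eq F _≡_ (finite sets are lists up to mutual inclusion):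
--   (1) fmap is a functor up to this equality;
--   (2) F weakly preserves pullbacks: two values x ∈ F(X), y ∈ F(Y) with
--       equal images in F(Z) come from one value of F(X ×_Z Y).
-- From (1), the graph of a coalgebra morphism is a bisimulation and the
-- converse of a bisimulation is one; from (2), the relational composite
-- of two bisimulations is one.  Hence ≼ is reflexive (identity morphism)
-- and transitive (composition).  For the meet (R, g) of C₁ and C₂: the
-- projections are morphisms, so (R, g) ≼ Cᵢ; and if D ≼ C₁ via R₁ and
-- D ≼ C₂ via R₂, then R₁⁻¹ ; R₂ is a bisimulation, hence contained in the
-- maximal R, which makes R₁ ; graph(π₁)⁻¹ a bisimulation from D to
-- (R, g) that is total on D.

open import Defs
open import Level using (0ℓ)
open import Function using (flip)
open import Data.Product using (Σ-syntax; _×_; _,_; proj₁; proj₂; map₂; swap)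
open import Data.List using (List; []; _∷_; map; _++_)
open import Data.List.Properties using (map-∘; map-id)
open import Data.List.Relation.Unary.All as All using (All; []; _∷_)
open import Data.List.Relation.Unary.Any as Any using (Any; here; there)
import Data.List.Relation.Unary.All.Properties as All
import Data.List.Relation.Unary.Any.Properties as Any
open import Data.List.Membership.Propositional using (find; lose)
open import Relation.Binary.Bundles using (Setoid)
open import Relation.Binary.Structures using (IsEquivalence)
open import Relation.Binary.Lattice.Bundles using (BoundedJoinSemilattice)
open import Relation.Binary.PropositionalEquality using (_≡_; refl; sym; trans; cong; subst)
import Relation.Binary.Reasoning.Setoid as SetoidReasoning

Covers : {X Y : Set} → (X → Y → Set) → List X → List Y → Set
Covers E xs ys = All (λ x → Any (E x) ys) xs

SetEq : {X : Set} → (X → X → Set) → List X → List X → Set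
SetEq E xs ys = Covers E xs ys × Covers (flip E) ys xs

covers-refl : {X : Set} {E : X → X → Set} → (∀ x → E x x) → ∀ xs → Covers E xs xs
covers-refl r []       = []
covers-refl r (x ∷ xs) = here (r x) ∷ All.map there (covers-refl r xs)

covers-mono : {X Y : Set} {E E' : X → Y → Set} → (∀ {x y} → E x y → E' x y) →
              ∀ {xs ys} → Covers E xs ys → Covers E' xs ys
covers-mono f = All.map (Any.map f)

covers-trans : {X Y Z : Set} {E : X → Y → Set} {E' : Y → Z → Set} {E'' : X → Z → Set} →
               (∀ {x y z} → E x y → E' y z → E'' x z) →
               ∀ {xs ys zs} → Covers E xs ys → Covers E' ys zs → Covers E'' xs zs
covers-trans t xy yz =
  All.map (λ x~ys → All.lookupWith (λ y~zs e → Any.map (t e) y~zs) yz x~ys) xy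

covers-mapˡ : {X X' Y : Set} {E : X' → Y → Set} (u : X → X') →
              ∀ {xs ys} → Covers (λ a b → E (u a) b) xs ys → Covers E (map u xs) ys
covers-mapˡ u = All.map⁺

covers-mapʳ : {X Y Y' : Set} {E : X → Y' → Set} (v : Y → Y') →
              ∀ {xs ys} → Covers (λ a b → E a (v b)) xs ys → Covers E xs (map v ys)
covers-mapʳ v = All.map Any.map⁺

covers-map⁻ : {X Y X' Y' : Set} {E : X' → Y' → Set} (u : X → X') (v : Y → Y') →
              ∀ {xs ys} → Covers E (map u xs) (map v ys) → Covers (λ a b → E (u a) (v b)) xs ys
covers-map⁻ u v c = All.map Any.map⁻ (All.map⁻ c)

setEq-map : {X Y : Set} {E : Y → Y → Set} (u v : X → Y) → (∀ a → E (u a) (v a)) →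
            ∀ xs → SetEq E (map u xs) (map v xs)
setEq-map u v r xs =
  covers-mapˡ u (covers-mapʳ v (covers-refl r xs)) ,
  covers-mapˡ v (covers-mapʳ u (covers-refl r xs))

-- Weak-pullback property of finite sets.
mediate-left : {X Y Z : Set} {Rel : X → Y → Set} {U : Z → X → Set} {V : Z → Y → Set} →
  (∀ {x y} → Rel x y → Σ[ z ∈ Z ] U z x × V z y) →
  ∀ {xs ys} → Covers Rel xs ys →
  Σ[ zs ∈ List Z ] Covers (flip U) xs zs × Covers U zs xs × Covers V zs ys
mediate-left med []               = [] , [] , [] , []
mediate-left med (x~ys ∷ xs~ys) with find x~ys | mediate-left med xs~ys
... | _ , y∈ys , r | zs , xs~zs , zs~xs , zs~ys with med r
... | z , u , v =
  z ∷ zs , here u ∷ All.map there xs~zs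
         , here u ∷ All.map there zs~xs
         , lose y∈ys v ∷ zs~ys

mediate : {X Y Z : Set} {Rel : X → Y → Set} {U : Z → X → Set} {V : Z → Y → Set} →
  (∀ {x y} → Rel x y → Σ[ z ∈ Z ] U z x × V z y) →
  ∀ {xs ys} → Covers Rel xs ys → Covers (flip Rel) ys xs →
  Σ[ zs ∈ List Z ] (Covers U zs xs × Covers (flip U) xs zs)
                 × (Covers V zs ys × Covers (flip V) ys zs)
mediate med xs~ys ys~xs
  with mediate-left med xs~ys | mediate-left (λ r → map₂ swap (med r)) ys~xs
... | zs₁ , xs~zs₁ , zs₁~xs , zs₁~ys | zs₂ , ys~zs₂ , zs₂~ys , zs₂~xs =
  zs₁ ++ zs₂ , (All.++⁺ zs₁~xs zs₂~xs , All.map Any.++⁺ˡ xs~zs₁)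
             , (All.++⁺ zs₁~ys zs₂~ys , All.map (Any.++⁺ʳ zs₁) ys~zs₂)

module _ {A : Set} where

  EqF : (F : Fun A) {X : Set} → ⟦ F ⟧ X → ⟦ F ⟧ X → Set
  EqF F = Eq F _≡_

  syntax EqF F x y = x ≈[ F ] y

  ≈-refl : (F : Fun A) {X : Set} (x : ⟦ F ⟧ X) → x ≈[ F ] x
  ≈-refl Id       x       = refl
  ≈-refl (K B)    x       = IsEquivalence.refl (BoundedJoinSemilattice.isEquivalence B)
  ≈-refl (F ⊗F G) (x , y) = ≈-refl F x , ≈-refl G y
  ≈-refl (Exp G)  h       = λ a → ≈-refl G (h a)
  ≈-refl (Pω G)   xs      = covers-refl (≈-refl G) xs , covers-refl (≈-refl G) xs

  ≈-sym : (F : Fun A) {X : Set} {x y : ⟦ F ⟧ X} → x ≈[ F ] y → y ≈[ F ] x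
  ≈-sym Id       e        = sym e
  ≈-sym (K B)    e        = IsEquivalence.sym (BoundedJoinSemilattice.isEquivalence B) e
  ≈-sym (F ⊗F G) (e , e') = ≈-sym F e , ≈-sym G e'
  ≈-sym (Exp G)  e        = λ a → ≈-sym G (e a)
  ≈-sym (Pω G)   (e , e') = covers-mono (≈-sym G) e' , covers-mono (≈-sym G) e

  ≈-trans : (F : Fun A) {X : Set} {x y z : ⟦ F ⟧ X} →
            x ≈[ F ] y → y ≈[ F ] z → x ≈[ F ] z
  ≈-trans Id       e        f        = trans e f
  ≈-trans (K B)    e        f        =
    IsEquivalence.trans (BoundedJoinSemilattice.isEquivalence B) e f
  ≈-trans (F ⊗F G) (e , e') (f , f') = ≈-trans F e f , ≈-trans G e' f'
  ≈-trans (Exp G)  e        f        = λ a → ≈-trans G (e a) (f a)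
  ≈-trans (Pω G)   (e , e') (f , f') =
    covers-trans (≈-trans G) e f , covers-trans (flip (≈-trans G)) f' e'

  ≈-setoid : Fun A → Set → Setoid 0ℓ 0ℓ
  ≈-setoid F X = record
    { Carrier       = ⟦ F ⟧ X
    ; _≈_           = EqF F
    ; isEquivalence = record { refl = ≈-refl F _ ; sym = ≈-sym F ; trans = ≈-trans F }
    }

  fmap-cong : (F : Fun A) {X Y : Set} (f : X → Y) {x y : ⟦ F ⟧ X} →
              x ≈[ F ] y → fmap F f x ≈[ F ] fmap F f y
  fmap-cong Id       f e        = cong f e
  fmap-cong (K B)    f e        = e
  fmap-cong (F ⊗F G) f (e , e') = fmap-cong F f e , fmap-cong G f e'
  fmap-cong (Exp G)  f e        = λ a → fmap-cong G f (e a)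
  fmap-cong (Pω G)   f (e , e') =
    covers-mapˡ (fmap G f) (covers-mapʳ (fmap G f) (covers-mono (fmap-cong G f) e)) ,
    covers-mapˡ (fmap G f) (covers-mapʳ (fmap G f) (covers-mono (fmap-cong G f) e'))

  fmap-comp : (F : Fun A) {X Y Z : Set} (f : Y → Z) (g : X → Y) (h : X → Z) →
              (∀ a → f (g a) ≡ h a) →
              (x : ⟦ F ⟧ X) → fmap F f (fmap F g x) ≈[ F ] fmap F h x
  fmap-comp Id       f g h p x       = p x
  fmap-comp (K B) {Z = Z} f g h p x   = ≈-refl (K B) {X = Z} x
  fmap-comp (F ⊗F G) f g h p (x , y) = fmap-comp F f g h p x , fmap-comp G f g h p y
  fmap-comp (Exp G)  f g h p k       = λ a → fmap-comp G f g h p (k a)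
  fmap-comp (Pω G)   f g h p xs      =
    subst (λ ys → SetEq (EqF G) ys (map (fmap G h) xs)) (map-∘ xs)
      (setEq-map _ (fmap G h) (fmap-comp G f g h p) xs)

  fmap-id : (F : Fun A) {X : Set} (f : X → X) → (∀ a → f a ≡ a) →
            (x : ⟦ F ⟧ X) → fmap F f x ≈[ F ] x
  fmap-id Id       f p x       = p x
  fmap-id (K B) {X} f p x     = ≈-refl (K B) {X = X} x
  fmap-id (F ⊗F G) f p (x , y) = fmap-id F f p x , fmap-id G f p y
  fmap-id (Exp G)  f p k       = λ a → fmap-id G f p (k a)
  fmap-id (Pω G)   f p xs      =
    subst (SetEq (EqF G) (map (fmap G f) xs)) (map-id xs)
      (setEq-map (fmap G f) (λ a → a) (fmap-id G f p) xs)

  record Pullback {X Y Z : Set} (p : X → Z) (q : Y → Z) : Set where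
    constructor joint
    field
      pbˡ   : X
      pbʳ   : Y
      agree : p pbˡ ≡ q pbʳ
  open Pullback public

  weak-pullback : (F : Fun A) {X Y Z : Set} (p : X → Z) (q : Y → Z)
    (x : ⟦ F ⟧ X) (y : ⟦ F ⟧ Y) → fmap F p x ≈[ F ] fmap F q y →
    Σ[ z ∈ ⟦ F ⟧ (Pullback p q) ] fmap F pbˡ z ≈[ F ] x × fmap F pbʳ z ≈[ F ] y
  weak-pullback Id p q x y e = joint x y e , refl , refl
  weak-pullback (K B) {X} p q x y e = x , ≈-refl (K B) {X = X} x , e
  weak-pullback (F ⊗F G) p q (x , x') (y , y') (e , e')
    with weak-pullback F p q x y e | weak-pullback G p q x' y' e'
  ... | z , zx , zy | z' , zx' , zy' = (z , z') , (zx , zx') , (zy , zy')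
  weak-pullback (Exp G) p q h k e =
    (λ a → proj₁ (lift a)) , (λ a → proj₁ (proj₂ (lift a))) , (λ a → proj₂ (proj₂ (lift a)))
    where
    lift : ∀ a → Σ[ z ∈ ⟦ G ⟧ (Pullback p q) ] fmap G pbˡ z ≈[ G ] h a × fmap G pbʳ z ≈[ G ] k a
    lift a = weak-pullback G p q (h a) (k a) (e a)
  weak-pullback (Pω G) p q xs ys (e , e')
    with mediate (λ {x} {y} → weak-pullback G p q x y)
                 (covers-map⁻ (fmap G p) (fmap G q) e) (covers-map⁻ (fmap G q) (fmap G p) e')
  ... | zs , (zs~xs , xs~zs) , (zs~ys , ys~zs) =
    zs , (covers-mapˡ (fmap G pbˡ) zs~xs , covers-mapʳ (fmap G pbˡ) xs~zs)
       , (covers-mapˡ (fmap G pbʳ) zs~ys , covers-mapʳ (fmap G pbʳ) ys~zs)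

  fmap-retract : (F : Fun A) {X Y : Set} (f : Y → X) (g : X → Y) → (∀ a → f (g a) ≡ a) →
                 (x : ⟦ F ⟧ X) → fmap F f (fmap F g x) ≈[ F ] x
  fmap-retract F f g p x =
    ≈-trans F (fmap-comp F f g (λ a → a) p x) (fmap-id F (λ a → a) (λ _ → refl) x)

module Bisimulations {A : Set} (F : Fun A) where

  IsHom : (C D : Coalg F) → (St C → St D) → Set
  IsHom C D h = ∀ x → fmap F h (str C x) ≈[ F ] str D (h x)

  Graph : {X Y : Set} → (X → Y) → BRel F X Y
  Graph h x y = h x ≡ y

  Converse : {X Y : Set} → BRel F X Y → BRel F Y X
  Converse R y x = R x y

  _⨾_ : {X Y Z : Set} → BRel F X Y → BRel F Y Z → BRel F X Z
  _⨾_ {Y = Y} R Q x z = Σ[ y ∈ Y ] R x y × Q y z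

  graph-bisim : (C D : Coalg F) (h : St C → St D) → IsHom C D h → IsBisim F C D (Graph h)
  graph-bisim C D h hom = witness , isWitness
    where
    into : St C → Carrier F (Graph h)
    into x = x , h x , refl

    witness : Carrier F (Graph h) → ⟦ F ⟧ (Carrier F (Graph h))
    witness (x , _ , _) = fmap F into (str C x)

    isWitness : IsWitness F C D (Graph h) witness
    isWitness (x , _ , refl) =
      ≈-sym F (fmap-retract F (π₁ F) into (λ _ → refl) (str C x)) ,
      ≈-sym F (≈-trans F (fmap-comp F (π₂ F) into h (λ _ → refl) (str C x)) (hom x))

  converse-bisim : (C₁ C₂ : Coalg F) (R : BRel F (St C₁) (St C₂)) →
                   IsBisim F C₁ C₂ R → IsBisim F C₂ C₁ (Converse R)
  converse-bisim C₁ C₂ R (g , isWitness) = witness , isWitness'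
    where
    transpose : Carrier F R → Carrier F (Converse R)
    transpose (a , b , r) = b , a , r

    witness : Carrier F (Converse R) → ⟦ F ⟧ (Carrier F (Converse R))
    witness (b , a , r) = fmap F transpose (g (a , b , r))

    isWitness' : IsWitness F C₂ C₁ (Converse R) witness
    isWitness' (b , a , r) =
      ≈-trans F (proj₂ (isWitness (a , b , r)))
        (≈-sym F (fmap-comp F (π₁ F) transpose (π₂ F) (λ _ → refl) (g (a , b , r)))) ,
      ≈-trans F (proj₁ (isWitness (a , b , r)))
        (≈-sym F (fmap-comp F (π₂ F) transpose (π₁ F) (λ _ → refl) (g (a , b , r))))

  -- the composite of two bisimulations is a bisimulation: at a pair
  -- related through s₂, the two witnesses agree on s₂, so by weak pullback
  -- preservation they are the two legs of one value over the pullback.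
  compose-bisim : (C₁ C₂ C₃ : Coalg F) (R : BRel F (St C₁) (St C₂)) (Q : BRel F (St C₂) (St C₃)) →
                  IsBisim F C₁ C₂ R → IsBisim F C₂ C₃ Q → IsBisim F C₁ C₃ (R ⨾ Q)
  compose-bisim C₁ C₂ C₃ R Q (gR , wR) (gQ , wQ) = witness , isWitness
    where
    Joint : Set
    Joint = Pullback (π₂ F {R = R}) (π₁ F {R = Q})

    glue : Joint → Carrier F (R ⨾ Q)
    glue (joint (a , b , r) (b' , c , q) b≡b') = a , c , b' , subst (R a) b≡b' r , q

    lift : ∀ s₁ s₂ s₃ (r : R s₁ s₂) (q : Q s₂ s₃) →
           Σ[ z ∈ ⟦ F ⟧ Joint ] fmap F pbˡ z ≈[ F ] gR (s₁ , s₂ , r)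
                              × fmap F pbʳ z ≈[ F ] gQ (s₂ , s₃ , q)
    lift s₁ s₂ s₃ r q =
      weak-pullback F (π₂ F) (π₁ F) (gR (s₁ , s₂ , r)) (gQ (s₂ , s₃ , q))
        (≈-trans F (≈-sym F (proj₂ (wR (s₁ , s₂ , r)))) (proj₁ (wQ (s₂ , s₃ , q))))

    witness : Carrier F (R ⨾ Q) → ⟦ F ⟧ (Carrier F (R ⨾ Q))
    witness (s₁ , s₃ , s₂ , r , q) = fmap F glue (proj₁ (lift s₁ s₂ s₃ r q))

    isWitness : IsWitness F C₁ C₃ (R ⨾ Q) witness
    isWitness (s₁ , s₃ , s₂ , r , q) = left , right
      where
      z : ⟦ F ⟧ Joint
      z = proj₁ (lift s₁ s₂ s₃ r q)

      zR : fmap F pbˡ z ≈[ F ] gR (s₁ , s₂ , r)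
      zR = proj₁ (proj₂ (lift s₁ s₂ s₃ r q))

      zQ : fmap F pbʳ z ≈[ F ] gQ (s₂ , s₃ , q)
      zQ = proj₂ (proj₂ (lift s₁ s₂ s₃ r q))

      left : str C₁ s₁ ≈[ F ] fmap F (π₁ F) (fmap F glue z)
      left = begin
        str C₁ s₁                         ≈⟨ proj₁ (wR (s₁ , s₂ , r)) ⟩
        fmap F (π₁ F) (gR (s₁ , s₂ , r))  ≈⟨ fmap-cong F (π₁ F) zR ⟨
        fmap F (π₁ F) (fmap F pbˡ z)      ≈⟨ fmap-comp F (π₁ F) pbˡ _ (λ _ → refl) z ⟩
        fmap F (λ w → π₁ F (glue w)) z    ≈⟨ fmap-comp F (π₁ F) glue _ (λ _ → refl) z ⟨
        fmap F (π₁ F) (fmap F glue z)     ∎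
        where open SetoidReasoning (≈-setoid F (St C₁))

      right : str C₃ s₃ ≈[ F ] fmap F (π₂ F) (fmap F glue z)
      right = begin
        str C₃ s₃                         ≈⟨ proj₂ (wQ (s₂ , s₃ , q)) ⟩
        fmap F (π₂ F) (gQ (s₂ , s₃ , q))  ≈⟨ fmap-cong F (π₂ F) zQ ⟨
        fmap F (π₂ F) (fmap F pbʳ z)      ≈⟨ fmap-comp F (π₂ F) pbʳ _ (λ _ → refl) z ⟩
        fmap F (λ w → π₂ F (glue w)) z    ≈⟨ fmap-comp F (π₂ F) glue _ (λ _ → refl) z ⟨
        fmap F (π₂ F) (fmap F glue z)     ∎
        where open SetoidReasoning (≈-setoid F (St C₃))

  hom⇒≼ : (C D : Coalg F) (h : St C → St D) → IsHom C D h → _≼_ F C D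
  hom⇒≼ C D h hom = Graph h , graph-bisim C D h hom , λ x → h x , refl

  ≼-refl : (C : Coalg F) → _≼_ F C C
  ≼-refl C = hom⇒≼ C C (λ x → x) (λ x → fmap-id F (λ x → x) (λ _ → refl) (str C x))

  ≼-trans : (C₁ C₂ C₃ : Coalg F) → _≼_ F C₁ C₂ → _≼_ F C₂ C₃ → _≼_ F C₁ C₃
  ≼-trans C₁ C₂ C₃ (R , R-bisim , R-total) (Q , Q-bisim , Q-total) =
    R ⨾ Q , compose-bisim C₁ C₂ C₃ R Q R-bisim Q-bisim , total
    where
    total : TotalOnLeft F (R ⨾ Q)
    total s₁ with R-total s₁
    ... | s₂ , r with Q-total s₂
    ... | s₃ , q = s₃ , s₂ , r , q

  π₁-hom : (C₁ C₂ : Coalg F) (R : BRel F (St C₁) (St C₂)) (g : Carrier F R → ⟦ F ⟧ (Carrier F R)) →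
           IsWitness F C₁ C₂ R g → IsHom (coalg (Carrier F R) g) C₁ (π₁ F)
  π₁-hom C₁ C₂ R g isWitness r = ≈-sym F (proj₁ (isWitness r))

  π₂-hom : (C₁ C₂ : Coalg F) (R : BRel F (St C₁) (St C₂)) (g : Carrier F R → ⟦ F ⟧ (Carrier F R)) →
           IsWitness F C₁ C₂ R g → IsHom (coalg (Carrier F R) g) C₂ (π₂ F)
  π₂-hom C₁ C₂ R g isWitness r = ≈-sym F (proj₂ (isWitness r))

  -- Every common lower bound D of C₁, C₂ lies below (R, g) when R is the
  -- maximal bisimulation: D relates to the pairs (s₁, s₂) it reaches in C₁
  -- and C₂, which lie in R since R₁⁻¹ ; R₂ is a bisimulation.
  below-meet : (C₁ C₂ : Coalg F) (R : BRel F (St C₁) (St C₂)) (g : Carrier F R → ⟦ F ⟧ (Carrier F R)) →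
               IsMaxBisim F C₁ C₂ R → IsWitness F C₁ C₂ R g →
               (D : Coalg F) → _≼_ F D C₁ → _≼_ F D C₂ → _≼_ F D (coalg (Carrier F R) g)
  below-meet C₁ C₂ R g (_ , maximal) isWitness D (R₁ , R₁-bisim , R₁-total) (R₂ , R₂-bisim , R₂-total) =
    R₁ ⨾ Converse (Graph (π₁ F)) ,
    compose-bisim D C₁ M R₁ _ R₁-bisim
      (converse-bisim M C₁ _ (graph-bisim M C₁ (π₁ F) (π₁-hom C₁ C₂ R g isWitness))) ,
    total
    where
    M : Coalg F
    M = coalg (Carrier F R) g

    R₁⁻¹⨾R₂-bisim : IsBisim F C₁ C₂ (Converse R₁ ⨾ R₂)
    R₁⁻¹⨾R₂-bisim = compose-bisim C₁ D C₂ (Converse R₁) R₂ (converse-bisim D C₁ R₁ R₁-bisim) R₂-bisim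

    total : TotalOnLeft F (R₁ ⨾ Converse (Graph (π₁ F)))
    total d with R₁-total d | R₂-total d
    ... | s₁ , r₁ | s₂ , r₂ =
      (s₁ , s₂ , maximal _ R₁⁻¹⨾R₂-bisim s₁ s₂ (d , r₁ , r₂)) , s₁ , r₁ , refl

mainTheorem5 : (A : Set) (F : Fun A) →
    ((C : Coalg F) → _≼_ F C C)
    × ((C₁ C₂ C₃ : Coalg F) → _≼_ F C₁ C₂ → _≼_ F C₂ C₃ → _≼_ F C₁ C₃)
    × ((C₁ C₂ : Coalg F) (R : BRel F (St C₁) (St C₂))
    (g : Carrier F R → ⟦ F ⟧ (Carrier F R)) →
    IsMaxBisim F C₁ C₂ R → IsMaxWitness F C₁ C₂ R g →
    IsGLB F (coalg (Carrier F R) g) C₁ C₂)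
mainTheorem5 A F = ≼-refl , ≼-trans , meet
  where
  open Bisimulations F

  meet : (C₁ C₂ : Coalg F) (R : BRel F (St C₁) (St C₂)) (g : Carrier F R → ⟦ F ⟧ (Carrier F R)) →
         IsMaxBisim F C₁ C₂ R → IsMaxWitness F C₁ C₂ R g →
         IsGLB F (coalg (Carrier F R) g) C₁ C₂
  meet C₁ C₂ R g maxR (isWitness , _) =
    hom⇒≼ _ C₁ (π₁ F) (π₁-hom C₁ C₂ R g isWitness) ,
    hom⇒≼ _ C₂ (π₂ F) (π₂-hom C₁ C₂ R g isWitness) ,
    below-meet C₁ C₂ R g maxR isWitness
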